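{- Let $d>6$ and let $G$ be a finite simple $d$-regular graph such that $G^2$ is not complete. Let $R$ be a C region, let $v\in R$ satisfy $\deg_2(v)=2$ and $N_2'(v)=\{u\}$, and let $G_v$ be the connected component of $G-u$ containing $v$. Then every vertex of $R$ other than $u$ lies in $G_v$, and every vertex of $R$ is at distance at most $2$ from $u$.
   Context: $N_i(x)$ is the set of vertices at distance exactly $i$ from $x$, $N(x)=N_1(x)$, $\deg_2(x)=|N_2(x)|$; $N_2'(x)$ is the set of vertices of $N_2(x)$ adjacent to some vertex of $N_3(x)$. Let $X=\{x:\deg_2(x)<4\}$; $u\sim w$ on $X$ iff there is a sequence of vertices of $X$ from $u$ to $w$ with consecutive vertices at distance at most 2. A region is an equivalence class of $\sim$ together with all neighbors of its vertices. A C region is a region $R$ such that no vertex of $R$ has $\deg_2=1$ and some vertex $v'\in R$ satisfies $\deg_2(v')=2$ and $|N_2'(v')|=1$. -}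

module Defs where

open import Data.Nat using (ℕ; zero; suc; _<_)
open import Data.Fin using (Fin; _≟_)
open import Data.Bool using (Bool; true; false; _∧_; _∨_; not)
open import Data.List using (List; length; allFin; filterᵇ)
open import Data.Bool.ListAction using (any)
open import Data.Product using (Σ; ∃; _×_)
open import Data.Sum using (_⊎_)
open import Relation.Nullary using (¬_)
open import Relation.Nullary.Decidable using (⌊_⌋)
open import Relation.Binary.PropositionalEquality using (_≡_; _≢_)

record Graph (n : ℕ) : Set where
  field
    adj     : Fin n → Fin n → Bool
    sym     : ∀ x y → adj x y ≡ adj y x
    irrefl  : ∀ x → adj x x ≡ false

module _ {n : ℕ} (G : Graph n) where
  open Graph G

  Adj : Fin n → Fin n → Set
  Adj x y = adj x y ≡ true

  nbrs : Fin n → List (Fin n)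
  nbrs x = filterᵇ (adj x) (allFin n)

  Regular : ℕ → Set
  Regular d = ∀ x → length (nbrs x) ≡ d

  -- reach k x y = true  iff  dist(x,y) ≤ k
  reach : ℕ → Fin n → Fin n → Bool
  reach zero    x y = ⌊ x ≟ y ⌋
  reach (suc k) x y = reach k x y ∨ any (λ z → reach k x z ∧ adj z y) (allFin n)

  distEq : ℕ → Fin n → Fin n → Bool
  distEq zero    x y = reach zero x y
  distEq (suc i) x y = reach (suc i) x y ∧ not (reach i x y)

  Dist≤ : ℕ → Fin n → Fin n → Set
  Dist≤ k x y = reach k x y ≡ true

  -- N_i(x), listed in increasing order without repetition
  N : ℕ → Fin n → List (Fin n)
  N i x = filterᵇ (distEq i x) (allFin n)

  deg₂ : Fin n → ℕ
  deg₂ x = length (N 2 x)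

  N₂' : Fin n → List (Fin n)
  N₂' x = filterᵇ (λ y → distEq 2 x y ∧ any (λ z → distEq 3 x z ∧ adj y z) (allFin n)) (allFin n)

  SquareComplete : Set
  SquareComplete = ∀ x y → x ≢ y → Dist≤ 2 x y

  InX : Fin n → Set
  InX x = deg₂ x < 4

  data _∼_ : Fin n → Fin n → Set where
    start : ∀ {x} → InX x → x ∼ x
    step  : ∀ {x y z} → x ∼ y → InX z → Dist≤ 2 y z → x ∼ z

  InRegion : Fin n → Fin n → Set
  InRegion x₀ w = ∃ λ y → x₀ ∼ y × (y ≡ w ⊎ Adj y w)

  -- Regions are exactly the sets InRegion x₀ with x₀ ∈ X.
  IsCRegion : Fin n → Set
  IsCRegion x₀ =
    InX x₀ ×
    (∀ w → InRegion x₀ w → deg₂ w ≢ 1) ×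
    (∃ λ v′ → InRegion x₀ v′ × deg₂ v′ ≡ 2 × length (N₂' v′) ≡ 1)

  data InComp (u v : Fin n) : Fin n → Set where
    here  : v ≢ u → InComp u v v
    there : ∀ {y w} → InComp u v y → Adj y w → w ≢ u → InComp u v w

module Submission where

-- Let B be the ball of radius 2 around v; it has 1 + d + 2 = d + 3 vertices.  As u is the only
-- vertex of N₂(v) with a neighbour in N₃(v), every neighbour of a vertex of B ∖ {u} lies in B.
-- Counting inside B: two non-adjacent vertices of B ∖ {u} have a common neighbour (otherwise
-- 2d ≤ |B| − 2), and u has at least two neighbours outside B (one lies in N₃(v), and with
-- exactly one the degree sum (d + 2)d + (d − 1) of the subgraph induced by B would be odd).
-- Hence every vertex of B ∩ N[u] has deg₂ ≥ 4 (for u itself since d > 6), so no vertex of X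
-- lies in B ∩ N[u], and lying in B ∖ N[u] propagates along ∼ from v to the whole class.  Thus
-- the region lies in B ∖ {u}, whose vertices are joined to v by paths of length ≤ 2 avoiding u;
-- and a region vertex w at distance > 2 from u would have N₂(w) = B ∖ (N[w] ∪ {u}), a single
-- vertex, which a C region forbids.

open import Data.Bool using (Bool; true; false; _∧_; _∨_; not; if_then_else_; T?)
open import Data.Bool.ListAction using (any)
open import Data.Bool.Properties using (∧-conicalˡ; ∧-conicalʳ; ∨-zeroʳ; ¬-not; T-≡)
import Data.Bool.Properties as Bool
open import Data.Empty using (⊥; ⊥-elim)
open import Data.Fin using (Fin; zero; suc; _≟_)
import Data.Fin.Properties as Fin
open import Data.List using (_∷_; []; length; filterᵇ; allFin; tabulate)
open import Data.List.Membership.Propositional using (lose) renaming (_∈_ to _∈ᴸ_)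
open import Data.List.Membership.Propositional.Properties using (∈-allFin; ∈-filter⁺; ∈-filter⁻)
open import Data.List.Relation.Unary.Any using (here; satisfied)
open import Data.List.Relation.Unary.Any.Properties using (any⁺; any⁻)
open import Data.Nat using (ℕ; zero; suc; _+_; _*_; _≤_; _<_; z≤n; s≤s; parity)
open import Data.Nat.Properties
  using ( +-*-semiring; +-comm; +-suc; +-identityʳ; *-identityˡ; suc-injective
        ; +-mono-≤; +-monoˡ-≤; +-monoʳ-≤; +-cancelˡ-≤; +-cancelˡ-≡
        ; ≤-antisym; ≤-trans; ≤-pred; _≤?_; ≰⇒>; <⇒≱; <⇒≢; ≤∧≢⇒<; module ≤-Reasoning)
open import Data.Nat.Tactic.RingSolver using (solve-∀)
open import Algebra.Properties.Semiring.Sum +-*-semiring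
  using (sum-syntax; sum-cong-≗; ∑-distrib-+; *-distribʳ-sum)
open import Data.Parity.Base using (0ℙ; 1ℙ) renaming (_+_ to _⊕_)
import Data.Parity.Properties as ℙ
open import Data.Product using (∃; _×_; _,_; proj₁; proj₂)
open import Data.Sum using (_⊎_; inj₁; inj₂; [_,_]′)
open import Function using (case_of_; _∘_; id; Equivalence)
open import Relation.Nullary using (¬_; Dec; yes; no)
open import Relation.Nullary.Decidable using (⌊_⌋)
open import Relation.Binary.PropositionalEquality

open import Defs

private variable
  n : ℕ
  p q : Fin n → Bool

-- Counting the elements of Boolean predicates on Fin n

indicator : Bool → ℕ
indicator b = if b then 1 else 0

infix  4 _∈_ _∉_ _⊆_
infixr 7 _∩_
infixr 6 _∪_

_∈_ _∉_ : Fin n → (Fin n → Bool) → Set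
x ∈ p = p x ≡ true
x ∉ p = ¬ x ∈ p

_∈?_ : ∀ (x : Fin n) p → Dec (x ∈ p)
x ∈? p = p x Bool.≟ true

_⊆_ : (Fin n → Bool) → (Fin n → Bool) → Set
p ⊆ q = ∀ {x} → x ∈ p → x ∈ q

Disjoint : (Fin n → Bool) → (Fin n → Bool) → Set
Disjoint p q = ∀ {x} → x ∈ p → x ∈ q → ⊥

-- Opaque, so that the predicates in membership goals are found by unification.
opaque
  _∩_ _∪_ : (Fin n → Bool) → (Fin n → Bool) → Fin n → Bool
  (p ∩ q) x = p x ∧ q x
  (p ∪ q) x = p x ∨ q x

  ∁ : (Fin n → Bool) → Fin n → Bool
  ∁ p x = not (p x)

  ⁅_⁆ : Fin n → Fin n → Bool
  ⁅ a ⁆ x = ⌊ x ≟ a ⌋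

opaque
  unfolding _∩_

  x∈p∩q⁺ : ∀ {x} → x ∈ p × x ∈ q → x ∈ p ∩ q
  x∈p∩q⁺ (px , qx) = cong₂ _∧_ px qx

  x∈p∩q⁻ : ∀ {x} → x ∈ p ∩ q → x ∈ p × x ∈ q
  x∈p∩q⁻ {p = p} {q} {x} h = ∧-conicalˡ (p x) (q x) h , ∧-conicalʳ (p x) (q x) h

  x∈p∪q⁺ : ∀ {x} → x ∈ p ⊎ x ∈ q → x ∈ p ∪ q
  x∈p∪q⁺ (inj₁ px) rewrite px = refl
  x∈p∪q⁺ {p = p} {x = x} (inj₂ qx) rewrite qx = ∨-zeroʳ (p x)

  x∈p∪q⁻ : ∀ {x} → x ∈ p ∪ q → x ∈ p ⊎ x ∈ q
  x∈p∪q⁻ {p = p} {x = x} h with p x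
  ... | true  = inj₁ refl
  ... | false = inj₂ h

  x∈∁p⁺ : ∀ {x} → x ∉ p → x ∈ ∁ p
  x∈∁p⁺ x∉p = cong not (¬-not x∉p)

  x∈∁p⁻ : ∀ {x} → x ∈ ∁ p → x ∉ p
  x∈∁p⁻ x∈∁p x∈p rewrite x∈p = case x∈∁p of λ ()

  x∈⁅x⁆ : ∀ {x : Fin n} → x ∈ ⁅ x ⁆
  x∈⁅x⁆ {x = x} with x ≟ x
  ... | yes _  = refl
  ... | no x≢x = ⊥-elim (x≢x refl)

  x∈⁅y⁆⇒x≡y : ∀ {x y : Fin n} → x ∈ ⁅ y ⁆ → x ≡ y
  x∈⁅y⁆⇒x≡y {x = x} {y} h with x ≟ y
  ... | yes x≡y = x≡y

x≢y⇒x∈∁⁅y⁆ : ∀ {x y : Fin n} → x ≢ y → x ∈ ∁ ⁅ y ⁆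
x≢y⇒x∈∁⁅y⁆ x≢y = x∈∁p⁺ (x≢y ∘ x∈⁅y⁆⇒x≡y)

opaque
  ∣_∣ : (Fin n → Bool) → ℕ
  ∣_∣ {n} p = ∑[ x < n ] indicator (p x)

opaque
  unfolding ∣_∣ _∩_

  ∣p∣≡∣p∩q∣+∣p∩∁q∣ : ∀ (p q : Fin n → Bool) → ∣ p ∣ ≡ ∣ p ∩ q ∣ + ∣ p ∩ ∁ q ∣
  ∣p∣≡∣p∩q∣+∣p∩∁q∣ p q = trans (sum-cong-≗ λ x → split (p x) (q x))
    (∑-distrib-+ (λ x → indicator (p x ∧ q x)) (λ x → indicator (p x ∧ not (q x))))
    where
    split : ∀ a b → indicator a ≡ indicator (a ∧ b) + indicator (a ∧ not b)
    split false _     = refl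
    split true  true  = refl
    split true  false = refl

  ∣p∪q∣≡∣p∣+∣q∣ : Disjoint p q → ∣ p ∪ q ∣ ≡ ∣ p ∣ + ∣ q ∣
  ∣p∪q∣≡∣p∣+∣q∣ {p = p} {q} disjoint = trans (sum-cong-≗ pointwise)
    (∑-distrib-+ (λ x → indicator (p x)) (λ x → indicator (q x)))
    where
    pointwise : ∀ x → indicator (p x ∨ q x) ≡ indicator (p x) + indicator (q x)
    pointwise x with p x in px | q x in qx
    ... | true  | true  = ⊥-elim (disjoint px qx)
    ... | true  | false = refl
    ... | false | _     = refl

opaque
  unfolding ∣_∣

  ∣p∣≡p₀+∣p∘suc∣ : ∀ (p : Fin (suc n) → Bool) → ∣ p ∣ ≡ indicator (p zero) + ∣ (λ i → p (suc i)) ∣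
  ∣p∣≡p₀+∣p∘suc∣ p = refl

  ∑-indicator-* : ∀ (p : Fin n → Bool) a → ∑[ x < n ] (indicator (p x) * a) ≡ ∣ p ∣ * a
  ∑-indicator-* p a = sym (*-distribʳ-sum a (λ x → indicator (p x)))

  length-filterᵇ-allFin : ∀ (p : Fin n → Bool) → length (filterᵇ p (allFin n)) ≡ ∣ p ∣
  length-filterᵇ-allFin {n} p = length-filterᵇ-tabulate id
    where
    length-filterᵇ-tabulate : ∀ {m} (f : Fin m → Fin n) →
      length (filterᵇ p (tabulate f)) ≡ ∑[ i < m ] indicator (p (f i))
    length-filterᵇ-tabulate {zero}  f = refl
    length-filterᵇ-tabulate {suc m} f with p (f zero)
    ... | true  = cong suc (length-filterᵇ-tabulate (f ∘ suc))
    ... | false = length-filterᵇ-tabulate (f ∘ suc)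

  ∣∣-mono : p ⊆ q → ∣ p ∣ ≤ ∣ q ∣
  ∣∣-mono {zero}          _   = z≤n
  ∣∣-mono {suc n} {p} {q} p⊆q =
    +-mono-≤ (indicator-mono p⊆q) (∣∣-mono {p = λ i → p (suc i)} {q = λ i → q (suc i)} p⊆q)
    where
    indicator-mono : ∀ {a b} → (a ≡ true → b ≡ true) → indicator a ≤ indicator b
    indicator-mono {false} _   = z≤n
    indicator-mono {true}  a⇒b rewrite a⇒b refl = s≤s z≤n

  ∣∅∣≡0 : (∀ x → x ∉ p) → ∣ p ∣ ≡ 0
  ∣∅∣≡0 {zero}          _     = refl
  ∣∅∣≡0 {suc n} {p = p} empty with p zero in p0
  ... | true  = ⊥-elim (empty zero p0)
  ... | false = ∣∅∣≡0 {p = λ i → p (suc i)} (λ x → empty (suc x))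

  ∣p∣>0⇒∃ : 0 < ∣ p ∣ → ∃ λ x → x ∈ p
  ∣p∣>0⇒∃ {zero}          ()
  ∣p∣>0⇒∃ {suc n} {p = p} ∣p∣>0 with p zero in p0
  ... | true  = zero , p0
  ... | false = let x , px = ∣p∣>0⇒∃ {p = λ i → p (suc i)} ∣p∣>0 in suc x , px

∣∣-cong : p ⊆ q → q ⊆ p → ∣ p ∣ ≡ ∣ q ∣
∣∣-cong p⊆q q⊆p = ≤-antisym (∣∣-mono p⊆q) (∣∣-mono q⊆p)

∣⁅x⁆∣≡1 : ∀ (x : Fin n) → ∣ ⁅ x ⁆ ∣ ≡ 1
∣⁅x⁆∣≡1 zero    = trans (∣p∣≡p₀+∣p∘suc∣ ⁅ zero ⁆) (cong₂ _+_ (cong indicator x∈⁅x⁆)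
                    (∣∅∣≡0 λ i i∈⁅0⁆ → Fin.0≢1+n (sym (x∈⁅y⁆⇒x≡y i∈⁅0⁆))))
∣⁅x⁆∣≡1 (suc x) = trans (∣p∣≡p₀+∣p∘suc∣ ⁅ suc x ⁆)
  (cong₂ _+_ (cong indicator (¬-not λ 0∈⁅x+1⁆ → Fin.0≢1+n (x∈⁅y⁆⇒x≡y 0∈⁅x+1⁆)))
             (trans (∣∣-cong (λ h → subst (_∈ ⁅ x ⁆) (sym (Fin.suc-injective (x∈⁅y⁆⇒x≡y h))) x∈⁅x⁆)
                             (λ h → subst (λ i → suc i ∈ ⁅ suc x ⁆) (sym (x∈⁅y⁆⇒x≡y h)) x∈⁅x⁆))
                    (∣⁅x⁆∣≡1 x)))

∣p∣≡1+∣p∩∁⁅x⁆∣ : ∀ {x} → x ∈ p → ∣ p ∣ ≡ suc ∣ p ∩ ∁ ⁅ x ⁆ ∣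
∣p∣≡1+∣p∩∁⁅x⁆∣ {p = p} {x} x∈p = begin
  ∣ p ∣                            ≡⟨ ∣p∣≡∣p∩q∣+∣p∩∁q∣ p ⁅ x ⁆ ⟩
  ∣ p ∩ ⁅ x ⁆ ∣ + ∣ p ∩ ∁ ⁅ x ⁆ ∣  ≡⟨ cong (_+ ∣ p ∩ ∁ ⁅ x ⁆ ∣) (trans p∩⁅x⁆≡⁅x⁆ (∣⁅x⁆∣≡1 x)) ⟩
  suc ∣ p ∩ ∁ ⁅ x ⁆ ∣              ∎
  where
  open ≡-Reasoning
  p∩⁅x⁆≡⁅x⁆ : ∣ p ∩ ⁅ x ⁆ ∣ ≡ ∣ ⁅ x ⁆ ∣
  p∩⁅x⁆≡⁅x⁆ = ∣∣-cong (proj₂ ∘ x∈p∩q⁻)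
                      (λ y∈⁅x⁆ → x∈p∩q⁺ (subst (_∈ p) (sym (x∈⁅y⁆⇒x≡y y∈⁅x⁆)) x∈p , y∈⁅x⁆))

x∈p⇒∣p∣>0 : ∀ {x} → x ∈ p → 0 < ∣ p ∣
x∈p⇒∣p∣>0 {p = p} {x} x∈p = subst (_≤ ∣ p ∣) (∣⁅x⁆∣≡1 x)
  (∣∣-mono λ y∈⁅x⁆ → subst (_∈ p) (sym (x∈⁅y⁆⇒x≡y y∈⁅x⁆)) x∈p)

any-allFin⁺ : ∀ {x} → x ∈ p → any p (allFin n) ≡ true
any-allFin⁺ {p = p} {x} x∈p = Equivalence.to T-≡ (any⁺ p (lose (∈-allFin x) (Equivalence.from T-≡ x∈p)))

any-allFin⁻ : any p (allFin n) ≡ true → ∃ λ x → x ∈ p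
any-allFin⁻ {n} {p} h =
  let x , Tpx = satisfied (any⁻ p (allFin n) (Equivalence.from T-≡ h)) in x , Equivalence.to T-≡ Tpx

module _ {a : Fin n} (filter≡[a] : filterᵇ p (allFin n) ≡ a ∷ []) where

  filterᵇ≡[a]⇒a∈p : a ∈ p
  filterᵇ≡[a]⇒a∈p =
    Equivalence.to T-≡ (proj₂ (∈-filter⁻ (T? ∘ p) {xs = allFin n} (subst (a ∈ᴸ_) (sym filter≡[a]) (here refl))))

  filterᵇ≡[a]⇒x∈p⇒x≡a : ∀ {x} → x ∈ p → x ≡ a
  filterᵇ≡[a]⇒x∈p⇒x≡a {x} x∈p
    with subst (x ∈ᴸ_) filter≡[a] (∈-filter⁺ (T? ∘ p) (∈-allFin x) (Equivalence.from T-≡ x∈p))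
  ... | here x≡a = x≡a

-- The handshake lemma

opaque
  unfolding ∣_∣

  handshake : (E : Fin n → Fin n → Bool) → (∀ x y → E x y ≡ E y x) → (∀ x → E x x ≡ false) →
              parity (∑[ x < n ] ∣ E x ∣) ≡ 0ℙ
  handshake {zero}  E E-sym E-irrefl = refl
  handshake {suc n} E E-sym E-irrefl = begin
    parity (∣ E zero ∣ + ∑[ x < n ] ∣ E (suc x) ∣)  ≡⟨ cong parity (cong₂ _+_ row₀ rest) ⟩
    parity (c + (c + s))                            ≡⟨ ℙ.+-homo-+ c (c + s) ⟩
    parity c ⊕ parity (c + s)                       ≡⟨ cong (parity c ⊕_) (ℙ.+-homo-+ c s) ⟩
    parity c ⊕ (parity c ⊕ parity s)                ≡⟨ ℙ.+-assoc (parity c) (parity c) (parity s) ⟨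
    (parity c ⊕ parity c) ⊕ parity s                ≡⟨ cong (_⊕ parity s) (ℙ.p+p≡0ℙ (parity c)) ⟩
    0ℙ ⊕ parity s                                   ≡⟨ handshake (λ x y → E (suc x) (suc y))
                                                                 (λ x y → E-sym (suc x) (suc y)) (E-irrefl ∘ suc) ⟩
    0ℙ                                              ∎
    where
    open ≡-Reasoning
    c s : ℕ
    c = ∑[ y < n ] indicator (E zero (suc y))
    s = ∑[ x < n ] ∑[ y < n ] indicator (E (suc x) (suc y))
    row₀ : ∣ E zero ∣ ≡ c
    row₀ = cong (λ b → indicator b + c) (E-irrefl zero)
    rest : ∑[ x < n ] ∣ E (suc x) ∣ ≡ c + s
    rest = trans (∑-distrib-+ (λ x → indicator (E (suc x) zero)) (λ x → ∑[ y < n ] indicator (E (suc x) (suc y))))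
                 (cong (_+ s) (sum-cong-≗ λ x → cong indicator (E-sym (suc x) zero)))

parity[[m+3][m+1]+m]≡1ℙ : ∀ m → parity ((suc m + 2) * suc m + m) ≡ 1ℙ
parity[[m+3][m+1]+m]≡1ℙ m
  rewrite ℙ.+-homo-+ ((suc m + 2) * suc m) m | ℙ.*-homo-* (suc m + 2) (suc m)
        | ℙ.+-homo-+ 1 (m + 2) | ℙ.+-homo-+ m 2 | ℙ.+-homo-+ 1 m
  with parity m
... | 0ℙ = refl
... | 1ℙ = refl

7≤m+m⇒4≤m : ∀ {m} → 7 ≤ m + m → 4 ≤ m
7≤m+m⇒4≤m {m} 7≤m+m with 4 ≤? m
... | yes 4≤m = 4≤m
... | no  4≰m = let m≤3 = ≤-pred (≰⇒> 4≰m) in ⊥-elim (<⇒≱ 7≤m+m (+-mono-≤ m≤3 m≤3))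

-- Distances in a graph

not≡true⇒≢true : ∀ {b} → not b ≡ true → b ≢ true
not≡true⇒≢true {false} _ ()

module _ (G : Graph n) where
  open Graph G using (adj)

  private variable
    x y z : Fin n
    k : ℕ

  Adj-sym : Adj G x y → Adj G y x
  Adj-sym {x} {y} xy = trans (Graph.sym G y x) xy

  Adj⇒≢ : Adj G x y → x ≢ y
  Adj⇒≢ {x} xx refl = case trans (sym xx) (Graph.irrefl G x) of λ ()

  Dist≤0⇒≡ : Dist≤ G 0 x y → x ≡ y
  Dist≤0⇒≡ {x} {y} h with x ≟ y
  ... | yes x≡y = x≡y

  Dist≤-refl : ∀ k x → Dist≤ G k x x
  Dist≤-refl zero    x with x ≟ x
  ... | yes _  = refl
  ... | no x≢x = ⊥-elim (x≢x refl)
  Dist≤-refl (suc k) x rewrite Dist≤-refl k x = refl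

  Dist≤-weaken : ∀ k → Dist≤ G k x y → Dist≤ G (suc k) x y
  Dist≤-weaken k h rewrite h = refl

  Dist≤-step : ∀ k → Dist≤ G k x z → Adj G z y → Dist≤ G (suc k) x y
  Dist≤-step {x} {z} {y} k xz zy =
    trans (cong (reach G k x y ∨_) (any-allFin⁺ {p = λ z → reach G k x z ∧ adj z y} (cong₂ _∧_ xz zy)))
          (∨-zeroʳ (reach G k x y))

  Dist≤-suc⁻ : Dist≤ G (suc k) x y → Dist≤ G k x y ⊎ ∃ λ z → Dist≤ G k x z × Adj G z y
  Dist≤-suc⁻ {k} {x} {y} h with reach G k x y
  ... | true  = inj₁ refl
  ... | false = let z , xzy = any-allFin⁻ h in
                inj₂ (z , ∧-conicalˡ _ _ xzy , ∧-conicalʳ _ _ xzy)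

  Dist≤1⁻ : Dist≤ G 1 x y → x ≡ y ⊎ Adj G x y
  Dist≤1⁻ h with Dist≤-suc⁻ {k = 0} h
  ... | inj₁ xy            = inj₁ (Dist≤0⇒≡ xy)
  ... | inj₂ (z , xz , zy) rewrite Dist≤0⇒≡ xz = inj₂ zy

  Dist≤2⁻ : Dist≤ G 2 x y → x ≡ y ⊎ Adj G x y ⊎ ∃ λ z → Adj G x z × Adj G z y
  Dist≤2⁻ h with Dist≤-suc⁻ {k = 1} h
  ... | inj₁ xy with Dist≤1⁻ xy
  ...   | inj₁ x≡y = inj₁ x≡y
  ...   | inj₂ x~y = inj₂ (inj₁ x~y)
  Dist≤2⁻ h | inj₂ (z , xz , zy) with Dist≤1⁻ xz
  ...   | inj₁ refl = inj₂ (inj₁ zy)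
  ...   | inj₂ x~z  = inj₂ (inj₂ (z , x~z , zy))

  Adj⇒Dist≤1 : Adj G x y → Dist≤ G 1 x y
  Adj⇒Dist≤1 {x} = Dist≤-step 0 (Dist≤-refl 0 x)

  Adj⇒Dist≤2 : Adj G x y → Dist≤ G 2 x y
  Adj⇒Dist≤2 x~y = Dist≤-weaken 1 (Adj⇒Dist≤1 x~y)

  path⇒Dist≤2 : Adj G x z → Adj G z y → Dist≤ G 2 x y
  path⇒Dist≤2 xz = Dist≤-step 1 (Adj⇒Dist≤1 xz)

  Dist≤2-sym : Dist≤ G 2 x y → Dist≤ G 2 y x
  Dist≤2-sym {x} h with Dist≤2⁻ h
  ... | inj₁ refl                 = Dist≤-refl 2 x
  ... | inj₂ (inj₁ xy)            = Adj⇒Dist≤2 (Adj-sym xy)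
  ... | inj₂ (inj₂ (z , xz , zy)) = path⇒Dist≤2 (Adj-sym zy) (Adj-sym xz)

  distEq⁻ : ∀ k → distEq G (suc k) x y ≡ true → Dist≤ G (suc k) x y × ¬ Dist≤ G k x y
  distEq⁻ k h = ∧-conicalˡ _ _ h , not≡true⇒≢true (∧-conicalʳ _ _ h)

  distEq₂⁺ : Adj G x z → Adj G z y → x ≢ y → ¬ Adj G x y → distEq G 2 x y ≡ true
  distEq₂⁺ xz zy x≢y x≁y = cong₂ _∧_ (path⇒Dist≤2 xz zy)
    (cong not (¬-not λ h → case Dist≤1⁻ h of λ { (inj₁ x≡y) → x≢y x≡y ; (inj₂ x~y) → x≁y x~y }))

  ∼-InXʳ : _∼_ G x y → InX G y
  ∼-InXʳ (start x∈X)    = x∈X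
  ∼-InXʳ (step _ y∈X _) = y∈X

  ∼-trans : _∼_ G x y → _∼_ G y z → _∼_ G x z
  ∼-trans x∼y (start _)          = x∼y
  ∼-trans x∼y (step y∼w z∈X w≈z) = step (∼-trans x∼y y∼w) z∈X w≈z

  ∼-sym : _∼_ G x y → _∼_ G y x
  ∼-sym (start x∈X)        = start x∈X
  ∼-sym (step x∼w y∈X w≈y) = ∼-trans (step (start y∈X) (∼-InXʳ x∼w) (Dist≤2-sym w≈y)) (∼-sym x∼w)

  ∼-preserves : (P : Fin n → Set) → (∀ {y z} → P y → InX G z → Dist≤ G 2 y z → P z) →
                _∼_ G x y → P x → P y
  ∼-preserves P P-step (start _)          Px = Px
  ∼-preserves P P-step (step x∼w y∈X w≈y) Px = P-step (∼-preserves P P-step x∼w Px) y∈X w≈y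

  deg₂≡∣distEq₂∣ : ∀ x → deg₂ G x ≡ ∣ distEq G 2 x ∣
  deg₂≡∣distEq₂∣ x = length-filterᵇ-allFin (distEq G 2 x)

-- Regular graphs

module _ {d} (G : Graph n) (G-regular : Regular G d) where
  open Graph G using (adj)

  ∣adj∣≡d : ∀ x → ∣ adj x ∣ ≡ d
  ∣adj∣≡d x = trans (sym (length-filterᵇ-allFin (adj x))) (G-regular x)

  ∣ball₁∣≡1+d : ∀ x → ∣ reach G 1 x ∣ ≡ suc d
  ∣ball₁∣≡1+d x = trans (∣p∣≡1+∣p∩∁⁅x⁆∣ (Dist≤-refl G 1 x)) (cong suc (trans (∣∣-cong to from) (∣adj∣≡d x)))
    where
    to : reach G 1 x ∩ ∁ ⁅ x ⁆ ⊆ adj x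
    to h with x∈p∩q⁻ h
    ... | x≈y , y∉⁅x⁆ with Dist≤1⁻ G x≈y
    ...   | inj₁ refl = ⊥-elim (x∈∁p⁻ y∉⁅x⁆ x∈⁅x⁆)
    ...   | inj₂ x~y  = x~y
    from : adj x ⊆ reach G 1 x ∩ ∁ ⁅ x ⁆
    from x~y = x∈p∩q⁺ (Adj⇒Dist≤1 G x~y , x∈∁p⁺ λ y∈⁅x⁆ → Adj⇒≢ G x~y (sym (x∈⁅y⁆⇒x≡y y∈⁅x⁆)))

  ∣ball₂∣≡1+d+deg₂ : ∀ x → ∣ reach G 2 x ∣ ≡ suc d + deg₂ G x
  ∣ball₂∣≡1+d+deg₂ x =
    trans (∣p∣≡∣p∩q∣+∣p∩∁q∣ (reach G 2 x) (reach G 1 x)) (cong₂ _+_ ∣ball₂∩ball₁∣≡1+d ∣ball₂∖ball₁∣≡deg₂)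
    where
    ball₁⊆ : reach G 1 x ⊆ reach G 2 x ∩ reach G 1 x
    ball₁⊆ h = x∈p∩q⁺ (Dist≤-weaken G 1 h , h)
    to : reach G 2 x ∩ ∁ (reach G 1 x) ⊆ distEq G 2 x
    to h = let x≈y , y∉ball₁ = x∈p∩q⁻ h in cong₂ _∧_ x≈y (cong not (¬-not (x∈∁p⁻ y∉ball₁)))
    from : distEq G 2 x ⊆ reach G 2 x ∩ ∁ (reach G 1 x)
    from h = let x≈y , y∉ball₁ = distEq⁻ G 1 h in x∈p∩q⁺ (x≈y , x∈∁p⁺ y∉ball₁)
    ∣ball₂∩ball₁∣≡1+d : ∣ reach G 2 x ∩ reach G 1 x ∣ ≡ suc d
    ∣ball₂∩ball₁∣≡1+d = trans (∣∣-cong (proj₂ ∘ x∈p∩q⁻) ball₁⊆) (∣ball₁∣≡1+d x)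
    ∣ball₂∖ball₁∣≡deg₂ : ∣ reach G 2 x ∩ ∁ (reach G 1 x) ∣ ≡ deg₂ G x
    ∣ball₂∖ball₁∣≡deg₂ = trans (∣∣-cong to from) (sym (deg₂≡∣distEq₂∣ G x))

  d≤1+∣common∣+deg₂ : ∀ {y u} → Adj G y u → d ≤ suc (∣ adj y ∩ adj u ∣ + deg₂ G u)
  d≤1+∣common∣+deg₂ {y} {u} y~u = begin
    d                                                   ≡⟨ ∣adj∣≡d y ⟨
    ∣ adj y ∣                                           ≤⟨ ∣∣-mono cover ⟩
    ∣ ⁅ u ⁆ ∪ (adj y ∩ adj u ∪ distEq G 2 u) ∣          ≡⟨ ∣p∪q∣≡∣p∣+∣q∣ u-apart ⟩
    ∣ ⁅ u ⁆ ∣ + ∣ adj y ∩ adj u ∪ distEq G 2 u ∣        ≡⟨ cong₂ _+_ (∣⁅x⁆∣≡1 u) (∣p∪q∣≡∣p∣+∣q∣ N≁N₂) ⟩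
    suc (∣ adj y ∩ adj u ∣ + ∣ distEq G 2 u ∣)          ≡⟨ cong (λ k → suc (∣ adj y ∩ adj u ∣ + k)) (deg₂≡∣distEq₂∣ G u) ⟨
    suc (∣ adj y ∩ adj u ∣ + deg₂ G u)                  ∎
    where
    open ≤-Reasoning
    cover : adj y ⊆ ⁅ u ⁆ ∪ (adj y ∩ adj u ∪ distEq G 2 u)
    cover {x} y~x with x ≟ u | adj u x in u~x
    ... | yes refl | _     = x∈p∪q⁺ (inj₁ x∈⁅x⁆)
    ... | no _     | true  = x∈p∪q⁺ (inj₂ (x∈p∪q⁺ (inj₁ (x∈p∩q⁺ (y~x , u~x)))))
    ... | no x≢u   | false = x∈p∪q⁺ (inj₂ (x∈p∪q⁺ (inj₂
                               (distEq₂⁺ G (Adj-sym G y~u) y~x (x≢u ∘ sym) λ u~x′ → case trans (sym u~x′) u~x of λ ()))))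
    u-apart : Disjoint ⁅ u ⁆ (adj y ∩ adj u ∪ distEq G 2 u)
    u-apart x∈⁅u⁆ h with x∈⁅y⁆⇒x≡y x∈⁅u⁆ | x∈p∪q⁻ h
    ... | refl | inj₁ common = Adj⇒≢ G (proj₂ (x∈p∩q⁻ common)) refl
    ... | refl | inj₂ far    = proj₂ (distEq⁻ G 1 far) (Dist≤-refl G 1 u)
    N≁N₂ : Disjoint (adj y ∩ adj u) (distEq G 2 u)
    N≁N₂ common far = proj₂ (distEq⁻ G 1 far) (Adj⇒Dist≤1 G (proj₂ (x∈p∩q⁻ common)))

-- Around a vertex v with deg₂ v = 2 and N₂'(v) = {u}

module CRegion {n d : ℕ} (G : Graph n) (6<d : 6 < d) (G-regular : Regular G d)
               (v u : Fin n) (deg₂v≡2 : deg₂ G v ≡ 2) (N₂'v≡[u] : N₂' G v ≡ u ∷ []) where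
  open Graph G using (adj)

  private variable
    x y z w : Fin n

  ball : Fin n → Bool
  ball = reach G 2 v

  u∈N₂[v] : distEq G 2 v u ≡ true
  u∈N₂[v] = ∧-conicalˡ _ _ (filterᵇ≡[a]⇒a∈p N₂'v≡[u])

  u-has-N₃-neighbour : ∃ λ z → distEq G 3 v z ≡ true × Adj G u z
  u-has-N₃-neighbour =
    let z , h = any-allFin⁻ (∧-conicalʳ _ _ (filterᵇ≡[a]⇒a∈p N₂'v≡[u])) in z , ∧-conicalˡ _ _ h , ∧-conicalʳ _ _ h

  N₂'-unique : distEq G 2 v y ≡ true → distEq G 3 v z ≡ true → Adj G y z → y ≡ u
  N₂'-unique {y} y∈N₂[v] z∈N₃[v] y~z = filterᵇ≡[a]⇒x∈p⇒x≡a N₂'v≡[u]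
    (cong₂ _∧_ y∈N₂[v] (any-allFin⁺ {p = λ z → distEq G 3 v z ∧ adj y z} (cong₂ _∧_ z∈N₃[v] y~z)))

  u∈ball : u ∈ ball
  u∈ball = proj₁ (distEq⁻ G 1 u∈N₂[v])

  v≁u : ¬ Adj G v u
  v≁u v~u = proj₂ (distEq⁻ G 1 u∈N₂[v]) (Adj⇒Dist≤1 G v~u)

  v≢u : v ≢ u
  v≢u refl = proj₂ (distEq⁻ G 1 u∈N₂[v]) (Dist≤-refl G 1 v)

  ball-closed : x ∈ ball → x ≢ u → Adj G x y → y ∈ ball
  ball-closed {x} {y} x∈ball x≢u x~y with x ∈? reach G 1 v | y ∈? ball
  ... | yes v≈₁x | _          = Dist≤-step G 1 v≈₁x x~y
  ... | no  _    | yes y∈ball = y∈ball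
  ... | no  v≉₁x | no  y∉ball = ⊥-elim (x≢u (N₂'-unique (cong₂ _∧_ x∈ball (cong not (¬-not v≉₁x)))
                              (cong₂ _∧_ (Dist≤-step G 2 x∈ball x~y) (cong not (¬-not y∉ball))) x~y))

  ∣ball∣≡d+3 : ∣ ball ∣ ≡ d + 3
  ∣ball∣≡d+3 = trans (∣ball₂∣≡1+d+deg₂ G G-regular v) (trans (cong (suc d +_) deg₂v≡2) (sym (+-suc d 2)))

  ∣ball∖⁅x⁆∖⁅y⁆∣≡d+1 : x ∈ ball → y ∈ ball → x ≢ y → ∣ (ball ∩ ∁ ⁅ x ⁆) ∩ ∁ ⁅ y ⁆ ∣ ≡ d + 1
  ∣ball∖⁅x⁆∖⁅y⁆∣≡d+1 x∈ball y∈ball x≢y = suc-injective (suc-injective (begin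
    suc (suc ∣ (ball ∩ ∁ ⁅ _ ⁆) ∩ ∁ ⁅ _ ⁆ ∣) ≡⟨ cong suc (∣p∣≡1+∣p∩∁⁅x⁆∣ (x∈p∩q⁺ (y∈ball , x≢y⇒x∈∁⁅y⁆ (x≢y ∘ sym)))) ⟨
    suc ∣ ball ∩ ∁ ⁅ _ ⁆ ∣                   ≡⟨ ∣p∣≡1+∣p∩∁⁅x⁆∣ x∈ball ⟨
    ∣ ball ∣                                 ≡⟨ ∣ball∣≡d+3 ⟩
    d + 3                                    ≡⟨ trans (+-suc d 2) (cong suc (+-suc d 1)) ⟩
    suc (suc (d + 1))                        ∎))
    where open ≡-Reasoning

  nonadjacent-in-ball⇒distEq₂ : x ∈ ball → y ∈ ball → x ≢ u → y ≢ u → x ≢ y → ¬ Adj G x y → distEq G 2 x y ≡ true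
  nonadjacent-in-ball⇒distEq₂ {x} {y} x∈ball y∈ball x≢u y≢u x≢y x≁y with ∣ adj x ∩ adj y ∣ in common
  ... | suc _ = let z , x~z∧y~z = ∣p∣>0⇒∃ (subst (0 <_) (sym common) (s≤s z≤n))
                    x~z , y~z   = x∈p∩q⁻ x~z∧y~z
                in distEq₂⁺ G x~z (Adj-sym G y~z) x≢y x≁y
  -- Otherwise N(x) and N(y) are disjoint d-sets inside the (d + 1)-set ball ∖ {x, y}.
  ... | zero  = ⊥-elim (<⇒≱ (≤-trans (s≤s (s≤s z≤n)) 6<d) (+-cancelˡ-≤ d d 1 d+d≤d+1))
    where
    disjoint : Disjoint (adj x) (adj y)
    disjoint x~z y~z = <⇒≢ (x∈p⇒∣p∣>0 (x∈p∩q⁺ (x~z , y~z))) (sym common)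
    cover : adj x ∪ adj y ⊆ (ball ∩ ∁ ⁅ x ⁆) ∩ ∁ ⁅ y ⁆
    cover h with x∈p∪q⁻ h
    ... | inj₁ x~z = x∈p∩q⁺ (x∈p∩q⁺ (ball-closed x∈ball x≢u x~z , x≢y⇒x∈∁⁅y⁆ (Adj⇒≢ G x~z ∘ sym))
                            , x≢y⇒x∈∁⁅y⁆ λ { refl → x≁y x~z })
    ... | inj₂ y~z = x∈p∩q⁺ (x∈p∩q⁺ (ball-closed y∈ball y≢u y~z , x≢y⇒x∈∁⁅y⁆ λ { refl → x≁y (Adj-sym G y~z) })
                            , x≢y⇒x∈∁⁅y⁆ (Adj⇒≢ G y~z ∘ sym))
    d+d≤d+1 : d + d ≤ d + 1
    d+d≤d+1 = begin
      d + d                            ≡⟨ cong₂ _+_ (∣adj∣≡d G G-regular x) (∣adj∣≡d G G-regular y) ⟨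
      ∣ adj x ∣ + ∣ adj y ∣            ≡⟨ ∣p∪q∣≡∣p∣+∣q∣ disjoint ⟨
      ∣ adj x ∪ adj y ∣                ≤⟨ ∣∣-mono cover ⟩
      ∣ (ball ∩ ∁ ⁅ x ⁆) ∩ ∁ ⁅ y ⁆ ∣   ≡⟨ ∣ball∖⁅x⁆∖⁅y⁆∣≡d+1 x∈ball y∈ball x≢y ⟩
      d + 1                            ∎
      where open ≤-Reasoning

  ball₁⊆ball : w ∈ ball → w ≢ u → reach G 1 w ⊆ ball
  ball₁⊆ball w∈ball w≢u h with Dist≤1⁻ G h
  ... | inj₁ refl = w∈ball
  ... | inj₂ w~x  = ball-closed w∈ball w≢u w~x

  ∣ball∖ball₁∣≡2 : w ∈ ball → w ≢ u → ∣ ball ∩ ∁ (reach G 1 w) ∣ ≡ 2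
  ∣ball∖ball₁∣≡2 {w} w∈ball w≢u = +-cancelˡ-≡ (suc d) _ 2 (begin
    suc d + ∣ ball ∩ ∁ (reach G 1 w) ∣                   ≡⟨ cong (_+ ∣ ball ∩ ∁ (reach G 1 w) ∣) ∣ball∩ball₁∣≡1+d ⟨
    ∣ ball ∩ reach G 1 w ∣ + ∣ ball ∩ ∁ (reach G 1 w) ∣  ≡⟨ ∣p∣≡∣p∩q∣+∣p∩∁q∣ ball (reach G 1 w) ⟨
    ∣ ball ∣                                             ≡⟨ ∣ball∣≡d+3 ⟩
    d + 3                                                ≡⟨ +-suc d 2 ⟩
    suc d + 2                                            ∎)
    where
    open ≡-Reasoning
    ∣ball∩ball₁∣≡1+d : ∣ ball ∩ reach G 1 w ∣ ≡ suc d
    ∣ball∩ball₁∣≡1+d = trans (∣∣-cong (proj₂ ∘ x∈p∩q⁻) (λ h → x∈p∩q⁺ (ball₁⊆ball w∈ball w≢u h , h)))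
                             (∣ball₁∣≡1+d G G-regular w)

  ball∖ball₁⊆N₂ : w ∈ ball → w ≢ u → x ∈ ball ∩ ∁ (reach G 1 w) → x ≢ u → distEq G 2 w x ≡ true
  ball∖ball₁⊆N₂ {w} w∈ball w≢u h x≢u =
    let x∈ball , x∉ball₁ = x∈p∩q⁻ h
        w≉₁x = x∈∁p⁻ x∉ball₁
    in nonadjacent-in-ball⇒distEq₂ w∈ball x∈ball w≢u x≢u
         (λ { refl → w≉₁x (Dist≤-refl G 1 w) }) (w≉₁x ∘ Adj⇒Dist≤1 G)

  u-inside u-outside : Fin n → Bool
  u-inside  = adj u ∩ ball
  u-outside = adj u ∩ ∁ ball

  1≤∣u-outside∣ : 1 ≤ ∣ u-outside ∣
  1≤∣u-outside∣ = let z , z∈N₃[v] , u~z = u-has-N₃-neighbour in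
    x∈p⇒∣p∣>0 (x∈p∩q⁺ (u~z , x∈∁p⁺ (proj₂ (distEq⁻ G 2 z∈N₃[v]))))

  induced : Fin n → Fin n → Bool
  induced x y = ball x ∧ (ball y ∧ adj x y)

  induced⁻ : induced x y ≡ true → x ∈ ball × y ∈ ball × Adj G x y
  induced⁻ {x} h = let y∈ball∧x~y = ∧-conicalʳ (ball x) _ h in
    ∧-conicalˡ _ _ h , ∧-conicalˡ _ _ y∈ball∧x~y , ∧-conicalʳ _ _ y∈ball∧x~y

  induced⁺ : x ∈ ball → y ∈ ball → Adj G x y → induced x y ≡ true
  induced⁺ x∈ball y∈ball x~y = cong₂ _∧_ x∈ball (cong₂ _∧_ y∈ball x~y)

  induced-sym : ∀ x y → induced x y ≡ induced y x
  induced-sym x y rewrite Graph.sym G x y with ball x | ball y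
  ... | true  | true  = refl
  ... | true  | false = refl
  ... | false | true  = refl
  ... | false | false = refl

  induced-irrefl : ∀ x → induced x x ≡ false
  induced-irrefl x rewrite Graph.irrefl G x with ball x
  ... | true  = refl
  ... | false = refl

  ∣induced∣ : ∀ x → ∣ induced x ∣ ≡ indicator ((ball ∩ ∁ ⁅ u ⁆) x) * d + indicator (⁅ u ⁆ x) * ∣ u-inside ∣
  ∣induced∣ x with x ≟ u | x ∈? ball
  ... | yes refl | _ = begin
    ∣ induced u ∣     ≡⟨ ∣∣-cong (λ h → let _ , y∈ball , u~y = induced⁻ h in x∈p∩q⁺ (u~y , y∈ball))
                                 (λ h → let u~y , y∈ball = x∈p∩q⁻ h in induced⁺ u∈ball y∈ball u~y) ⟩
    ∣ u-inside ∣      ≡⟨ +-identityʳ _ ⟨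
    ∣ u-inside ∣ + 0  ≡⟨ cong₂ (λ a b → a * d + b * ∣ u-inside ∣)
                             (cong indicator (¬-not λ h → x∈∁p⁻ (proj₂ (x∈p∩q⁻ h)) x∈⁅x⁆))
                             (cong indicator x∈⁅x⁆) ⟨
    indicator ((ball ∩ ∁ ⁅ u ⁆) u) * d + indicator (⁅ u ⁆ u) * ∣ u-inside ∣ ∎
    where open ≡-Reasoning
  ... | no x≢u | yes x∈ball = begin
    ∣ induced x ∣     ≡⟨ ∣∣-cong (λ h → proj₂ (proj₂ (induced⁻ h)))
                                 (λ x~y → induced⁺ x∈ball (ball-closed x∈ball x≢u x~y) x~y) ⟩
    ∣ adj x ∣         ≡⟨ ∣adj∣≡d G G-regular x ⟩
    d                 ≡⟨ trans (+-identityʳ (d + 0)) (+-identityʳ d) ⟨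
    d + 0 + 0         ≡⟨ cong₂ (λ a b → a * d + b * ∣ u-inside ∣)
                             (cong indicator (x∈p∩q⁺ (x∈ball , x≢y⇒x∈∁⁅y⁆ x≢u)))
                             (cong indicator (¬-not (x≢u ∘ x∈⁅y⁆⇒x≡y))) ⟨
    indicator ((ball ∩ ∁ ⁅ u ⁆) x) * d + indicator (⁅ u ⁆ x) * ∣ u-inside ∣ ∎
    where open ≡-Reasoning
  ... | no x≢u | no x∉ball = trans (∣∅∣≡0 λ _ h → x∉ball (proj₁ (induced⁻ h)))
    (sym (cong₂ (λ a b → a * d + b * ∣ u-inside ∣)
                (cong indicator (¬-not (x∉ball ∘ proj₁ ∘ x∈p∩q⁻)))
                (cong indicator (¬-not (x≢u ∘ x∈⁅y⁆⇒x≡y)))))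

  ∣ball∖⁅u⁆∣≡d+2 : ∣ ball ∩ ∁ ⁅ u ⁆ ∣ ≡ d + 2
  ∣ball∖⁅u⁆∣≡d+2 = suc-injective (trans (sym (∣p∣≡1+∣p∩∁⁅x⁆∣ u∈ball)) (trans ∣ball∣≡d+3 (+-suc d 2)))

  degree-sum : ∑[ x < n ] ∣ induced x ∣ ≡ (d + 2) * d + ∣ u-inside ∣
  degree-sum = begin
    ∑[ x < n ] ∣ induced x ∣                                          ≡⟨ sum-cong-≗ ∣induced∣ ⟩
    ∑[ x < n ] (indicator ((ball ∩ ∁ ⁅ u ⁆) x) * d + indicator (⁅ u ⁆ x) * m)
      ≡⟨ ∑-distrib-+ (λ x → indicator ((ball ∩ ∁ ⁅ u ⁆) x) * d) (λ x → indicator (⁅ u ⁆ x) * m) ⟩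
    ∑[ x < n ] (indicator ((ball ∩ ∁ ⁅ u ⁆) x) * d) + ∑[ x < n ] (indicator (⁅ u ⁆ x) * m)
      ≡⟨ cong₂ _+_ (∑-indicator-* (ball ∩ ∁ ⁅ u ⁆) d) (∑-indicator-* ⁅ u ⁆ m) ⟩
    ∣ ball ∩ ∁ ⁅ u ⁆ ∣ * d + ∣ ⁅ u ⁆ ∣ * m
      ≡⟨ cong₂ _+_ (cong (_* d) ∣ball∖⁅u⁆∣≡d+2) (trans (cong (_* m) (∣⁅x⁆∣≡1 u)) (*-identityˡ m)) ⟩
    (d + 2) * d + m                                                  ∎
    where
    open ≡-Reasoning
    m : ℕ
    m = ∣ u-inside ∣

  -- The degrees of the subgraph induced by the ball sum to (d + 2)d + ∣u-inside∣, odd if ∣u-outside∣ = 1.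
  ∣u-outside∣≢1 : ∣ u-outside ∣ ≢ 1
  ∣u-outside∣≢1 ∣u-outside∣≡1 = case parity-contradiction of λ ()
    where
    open ≡-Reasoning
    m : ℕ
    m = ∣ u-inside ∣
    d≡1+m : d ≡ suc m
    d≡1+m = begin
      d                  ≡⟨ ∣adj∣≡d G G-regular u ⟨
      ∣ adj u ∣          ≡⟨ ∣p∣≡∣p∩q∣+∣p∩∁q∣ (adj u) ball ⟩
      m + ∣ u-outside ∣  ≡⟨ cong (m +_) ∣u-outside∣≡1 ⟩
      m + 1              ≡⟨ +-comm m 1 ⟩
      suc m              ∎
    parity-contradiction : 0ℙ ≡ 1ℙ
    parity-contradiction = begin
      0ℙ                                ≡⟨ handshake induced induced-sym induced-irrefl ⟨
      parity (∑[ x < n ] ∣ induced x ∣) ≡⟨ cong parity degree-sum ⟩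
      parity ((d + 2) * d + m)          ≡⟨ cong (λ d → parity ((d + 2) * d + m)) d≡1+m ⟩
      parity ((suc m + 2) * suc m + m)  ≡⟨ parity[[m+3][m+1]+m]≡1ℙ m ⟩
      1ℙ                                ∎

  2≤∣u-outside∣ : 2 ≤ ∣ u-outside ∣
  2≤∣u-outside∣ = ≤∧≢⇒< 1≤∣u-outside∣ (∣u-outside∣≢1 ∘ sym)

  ball∖ball₁∪u-outside⊆N₂ : w ∈ ball → w ≢ u → Adj G w u → (ball ∩ ∁ (reach G 1 w)) ∪ u-outside ⊆ distEq G 2 w
  ball∖ball₁∪u-outside⊆N₂ {w} w∈ball w≢u w~u h with x∈p∪q⁻ h
  ... | inj₁ near = ball∖ball₁⊆N₂ w∈ball w≢u near
                      λ { refl → x∈∁p⁻ (proj₂ (x∈p∩q⁻ near)) (Adj⇒Dist≤1 G w~u) }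
  ... | inj₂ exit = let u~x , x∉ball = x∈p∩q⁻ exit
                        x∉ball′ = x∈∁p⁻ x∉ball
                    in distEq₂⁺ G w~u u~x (λ { refl → x∉ball′ w∈ball })
                                         (x∉ball′ ∘ ball-closed w∈ball w≢u)

  4≤deg₂-near-u : w ∈ ball → w ≢ u → Adj G w u → 4 ≤ deg₂ G w
  4≤deg₂-near-u {w} w∈ball w≢u w~u = begin
    4                                           ≤⟨ +-monoʳ-≤ 2 2≤∣u-outside∣ ⟩
    2 + ∣ u-outside ∣                           ≡⟨ cong (_+ ∣ u-outside ∣) (∣ball∖ball₁∣≡2 w∈ball w≢u) ⟨
    ∣ ball ∩ ∁ (reach G 1 w) ∣ + ∣ u-outside ∣  ≡⟨ ∣p∪q∣≡∣p∣+∣q∣ ball∖ball₁≁u-outside ⟨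
    ∣ (ball ∩ ∁ (reach G 1 w)) ∪ u-outside ∣    ≤⟨ ∣∣-mono (ball∖ball₁∪u-outside⊆N₂ w∈ball w≢u w~u) ⟩
    ∣ distEq G 2 w ∣                            ≡⟨ deg₂≡∣distEq₂∣ G w ⟨
    deg₂ G w                                    ∎
    where
    open ≤-Reasoning
    ball∖ball₁≁u-outside : Disjoint (ball ∩ ∁ (reach G 1 w)) u-outside
    ball∖ball₁≁u-outside inside exit = x∈∁p⁻ (proj₂ (x∈p∩q⁻ exit)) (proj₁ (x∈p∩q⁻ inside))

  common-neighbours-of-u : ∀ {a b} → Adj G u a → a ∉ ball → Adj G u b → b ∈ ball →
                           2 + (∣ adj a ∩ adj u ∣ + ∣ adj b ∩ adj u ∣) ≤ d
  common-neighbours-of-u {a} {b} u~a a∉ball u~b b∈ball = begin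
    2 + (∣ adj a ∩ adj u ∣ + ∣ adj b ∩ adj u ∣)   ≡⟨ cong (2 +_) (∣p∪q∣≡∣p∣+∣q∣ apart) ⟨
    2 + ∣ adj a ∩ adj u ∪ adj b ∩ adj u ∣         ≤⟨ +-monoʳ-≤ 2 (∣∣-mono cover) ⟩
    2 + ∣ (adj u ∩ ∁ ⁅ a ⁆) ∩ ∁ ⁅ b ⁆ ∣           ≡⟨ trans (∣p∣≡1+∣p∩∁⁅x⁆∣ u~a) (cong suc (∣p∣≡1+∣p∩∁⁅x⁆∣ b∈N[u]∖a)) ⟨
    ∣ adj u ∣                                     ≡⟨ ∣adj∣≡d G G-regular u ⟩
    d                                             ∎
    where
    open ≤-Reasoning
    in-ball : ∀ {x y} → Adj G u x → x ∈ ball → Adj G x y → y ∈ ball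
    in-ball u~x x∈ball = ball-closed x∈ball (Adj⇒≢ G u~x ∘ sym)
    b∈N[u]∖a : b ∈ adj u ∩ ∁ ⁅ a ⁆
    b∈N[u]∖a = x∈p∩q⁺ (u~b , x≢y⇒x∈∁⁅y⁆ λ { refl → a∉ball b∈ball })
    apart : Disjoint (adj a ∩ adj u) (adj b ∩ adj u)
    apart a~x∧u~x b~x∧u~x = let a~x , u~x = x∈p∩q⁻ a~x∧u~x ; b~x , _ = x∈p∩q⁻ b~x∧u~x in
      a∉ball (in-ball u~x (in-ball u~b b∈ball b~x) (Adj-sym G a~x))
    cover : adj a ∩ adj u ∪ adj b ∩ adj u ⊆ (adj u ∩ ∁ ⁅ a ⁆) ∩ ∁ ⁅ b ⁆
    cover h with x∈p∪q⁻ h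
    ... | inj₁ a~x∧u~x = let a~x , u~x = x∈p∩q⁻ a~x∧u~x in
      x∈p∩q⁺ (x∈p∩q⁺ (u~x , x≢y⇒x∈∁⁅y⁆ (Adj⇒≢ G a~x ∘ sym))
             , x≢y⇒x∈∁⁅y⁆ λ { refl → a∉ball (in-ball u~x b∈ball (Adj-sym G a~x)) })
    ... | inj₂ b~x∧u~x = let b~x , u~x = x∈p∩q⁻ b~x∧u~x in
      x∈p∩q⁺ (x∈p∩q⁺ (u~x , x≢y⇒x∈∁⁅y⁆ λ { refl → a∉ball (in-ball u~b b∈ball b~x) })
             , x≢y⇒x∈∁⁅y⁆ (Adj⇒≢ G b~x ∘ sym))

  -- Add up d ≤ 1 + ∣N(y) ∩ N(u)∣ + deg₂ u for a neighbour y of u outside the ball and one inside.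
  4≤deg₂u : 4 ≤ deg₂ G u
  4≤deg₂u = 7≤m+m⇒4≤m (≤-trans 6<d (+-cancelˡ-≤ d d (D + D) (begin
    d + d                        ≤⟨ +-mono-≤ (d≤1+∣common∣+deg₂ G G-regular (Adj-sym G u~a))
                                             (d≤1+∣common∣+deg₂ G G-regular c~u) ⟩
    suc (c₁ + D) + suc (c₂ + D)  ≡⟨ regroup c₁ c₂ D ⟩
    2 + (c₁ + c₂) + (D + D)      ≤⟨ +-monoˡ-≤ (D + D) (common-neighbours-of-u u~a a∉ball (Adj-sym G c~u) c∈ball) ⟩
    d + (D + D)                  ∎)))
    where
    open ≤-Reasoning
    a : Fin n
    a = proj₁ u-has-N₃-neighbour
    u~a : Adj G u a
    u~a = proj₂ (proj₂ u-has-N₃-neighbour)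
    a∉ball : a ∉ ball
    a∉ball = proj₂ (distEq⁻ G 2 (proj₁ (proj₂ u-has-N₃-neighbour)))
    middle : ∃ λ c → Adj G v c × Adj G c u
    middle with Dist≤2⁻ G u∈ball
    ... | inj₁ v≡u          = ⊥-elim (v≢u v≡u)
    ... | inj₂ (inj₁ v~u)   = ⊥-elim (v≁u v~u)
    ... | inj₂ (inj₂ v~c~u) = v~c~u
    c : Fin n
    c = proj₁ middle
    c~u : Adj G c u
    c~u = proj₂ (proj₂ middle)
    c∈ball : c ∈ ball
    c∈ball = Adj⇒Dist≤2 G (proj₁ (proj₂ middle))
    D c₁ c₂ : ℕ
    D  = deg₂ G u
    c₁ = ∣ adj a ∩ adj u ∣
    c₂ = ∣ adj c ∩ adj u ∣
    regroup : ∀ p q r → suc (p + r) + suc (q + r) ≡ 2 + (p + q) + (r + r)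
    regroup = solve-∀

  -- Since no vertex of X lies in ball ∩ N[u], this property propagates along ∼.
  Interior : Fin n → Set
  Interior x = x ∈ ball × x ≢ u × ¬ Adj G x u

  Interior-neighbour : Interior y → Adj G y w → w ∈ ball × w ≢ u
  Interior-neighbour (y∈ball , y≢u , y≁u) y~w = ball-closed y∈ball y≢u y~w , λ { refl → y≁u y~w }

  Interior-ball₂⊆ball : Interior y → Dist≤ G 2 y w → w ∈ ball
  Interior-ball₂⊆ball interior@(y∈ball , _) y≈₂w with Dist≤2⁻ G y≈₂w
  ... | inj₁ refl                   = y∈ball
  ... | inj₂ (inj₁ y~w)             = proj₁ (Interior-neighbour interior y~w)
  ... | inj₂ (inj₂ (c , y~c , c~w)) = let c∈ball , c≢u = Interior-neighbour interior y~c in ball-closed c∈ball c≢u c~w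

  Interior-v : Interior v
  Interior-v = Dist≤-refl G 2 v , v≢u , v≁u

  ball∩X⊆Interior : x ∈ ball → InX G x → Interior x
  ball∩X⊆Interior {x} x∈ball x∈X = x∈ball , x≢u , x≁u
    where
    x≢u : x ≢ u
    x≢u refl = <⇒≱ x∈X 4≤deg₂u
    x≁u : ¬ Adj G x u
    x≁u x~u = <⇒≱ x∈X (4≤deg₂-near-u x∈ball x≢u x~u)

  Interior-step : Interior y → InX G w → Dist≤ G 2 y w → Interior w
  Interior-step interior w∈X y≈₂w = ball∩X⊆Interior (Interior-ball₂⊆ball interior y≈₂w) w∈X

  Interior-near : Interior y → y ≡ w ⊎ Adj G y w → w ∈ ball × w ≢ u
  Interior-near (y∈ball , y≢u , _) (inj₁ refl) = y∈ball , y≢u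
  Interior-near interior           (inj₂ y~w)  = Interior-neighbour interior y~w

  region⊆ball∖u : ∀ {x₀} → InRegion G x₀ v → InRegion G x₀ w → w ∈ ball × w ≢ u
  region⊆ball∖u (y , x₀∼y , v-near-y) (y′ , x₀∼y′ , w-near-y′) =
    Interior-near (∼-preserves G Interior Interior-step (∼-trans G (∼-sym G x₀∼y) x₀∼y′) Interior-y) w-near-y′
    where
    Interior-y : Interior y
    Interior-y = [ (λ { refl → Interior-v })
                 , (λ y~v → ball∩X⊆Interior (Adj⇒Dist≤2 G (Adj-sym G y~v)) (∼-InXʳ G x₀∼y))
                 ]′ v-near-y

  ball∖u⊆component : w ∈ ball → w ≢ u → InComp G u v w
  ball∖u⊆component w∈ball w≢u with Dist≤2⁻ G w∈ball
  ... | inj₁ refl                   = here v≢u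
  ... | inj₂ (inj₁ v~w)             = there (here v≢u) v~w w≢u
  ... | inj₂ (inj₂ (c , v~c , c~w)) = there (there (here v≢u) v~c λ { refl → v≁u v~c }) c~w w≢u

  deg₂≡1-far-from-u : w ∈ ball → w ≢ u → ¬ Dist≤ G 2 w u → deg₂ G w ≡ 1
  deg₂≡1-far-from-u {w} w∈ball w≢u w≉₂u = begin
    deg₂ G w                                          ≡⟨ deg₂≡∣distEq₂∣ G w ⟩
    ∣ distEq G 2 w ∣                                  ≡⟨ ∣∣-cong N₂⊆ ⊆N₂ ⟩
    ∣ (ball ∩ ∁ (reach G 1 w)) ∩ ∁ ⁅ u ⁆ ∣            ≡⟨ suc-injective (trans (sym (∣p∣≡1+∣p∩∁⁅x⁆∣ u∈ball∖ball₁))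
                                                                            (∣ball∖ball₁∣≡2 w∈ball w≢u)) ⟩
    1                                                 ∎
    where
    open ≡-Reasoning
    interior : Interior w
    interior = w∈ball , w≢u , w≉₂u ∘ Adj⇒Dist≤2 G
    u∈ball∖ball₁ : u ∈ ball ∩ ∁ (reach G 1 w)
    u∈ball∖ball₁ = x∈p∩q⁺ (u∈ball , x∈∁p⁺ (w≉₂u ∘ Dist≤-weaken G 1))
    N₂⊆ : distEq G 2 w ⊆ (ball ∩ ∁ (reach G 1 w)) ∩ ∁ ⁅ u ⁆
    N₂⊆ h = let w≈₂x , w≉₁x = distEq⁻ G 1 h in
      x∈p∩q⁺ (x∈p∩q⁺ (Interior-ball₂⊆ball interior w≈₂x , x∈∁p⁺ w≉₁x) , x≢y⇒x∈∁⁅y⁆ λ { refl → w≉₂u w≈₂x })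
    ⊆N₂ : (ball ∩ ∁ (reach G 1 w)) ∩ ∁ ⁅ u ⁆ ⊆ distEq G 2 w
    ⊆N₂ h = let near , x∉⁅u⁆ = x∈p∩q⁻ h in
      ball∖ball₁⊆N₂ w∈ball w≢u near λ { refl → x∈∁p⁻ x∉⁅u⁆ x∈⁅x⁆ }

lemma4p4 : (n d : ℕ) (G : Graph n) → 6 < d → Regular G d → ¬ SquareComplete G →
    (x₀ : Fin n) → IsCRegion G x₀ →
    (v u : Fin n) → InRegion G x₀ v → deg₂ G v ≡ 2 → N₂' G v ≡ u ∷ [] →
    (∀ w → InRegion G x₀ w → w ≢ u → InComp G u v w) ×
    (∀ w → InRegion G x₀ w → Dist≤ G 2 w u)
lemma4p4 n d G 6<d G-regular _ x₀ (_ , no-deg₂-1 , _) v u v∈R deg₂v≡2 N₂'v≡[u] = in-component , near-u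
  where
  open CRegion G 6<d G-regular v u deg₂v≡2 N₂'v≡[u]
  in-component : ∀ w → InRegion G x₀ w → w ≢ u → InComp G u v w
  in-component w w∈R = ball∖u⊆component (proj₁ (region⊆ball∖u v∈R w∈R))
  near-u : ∀ w → InRegion G x₀ w → Dist≤ G 2 w u
  near-u w w∈R with u ∈? reach G 2 w
  ... | yes w≈₂u = w≈₂u
  ... | no  w≉₂u = let w∈ball , w≢u = region⊆ball∖u v∈R w∈R in
                   ⊥-elim (no-deg₂-1 w w∈R (deg₂≡1-far-from-u w∈ball w≢u w≉₂u))
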